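{- Let $g_1,\dots,g_s\in\mathbb{R}[X_1,\dots,X_{n_1},Y_1,\dots,Y_{n_2}]$ and $P_1,\dots,P_N\in\mathbb{R}[G_1,\dots,G_s]$. Then among the exponent vectors of the least terms of those polynomials $P_1(g_1,\dots,g_s),\dots,P_N(g_1,\dots,g_s)$ which are nonzero, at most $s$ are linearly independent.
   Context: For a nonzero polynomial $g\in\mathbb{R}[X_1,\dots,X_{n_1},Y_1,\dots,Y_{n_2}]$, its least term $lt(g)$ is the minimal term with respect to the following lexicographic ordering: first take the terms of minimal degree in $Y_{n_2}$, among them those of minimal degree in $Y_{n_2-1}$, and so on through $Y_1$, then $X_{n_1},\dots,X_1$. If $lt(g)=g_0X_1^{i_1}\cdots X_{n_1}^{i_{n_1}}Y_1^{j_1}\cdots Y_{n_2}^{j_{n_2}}$ with $g_0\in\mathbb{R}$, its exponent vector is $(i_1,\dots,i_{n_1},j_1,\dots,j_{n_2})$. -}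

module Defs where

open import Level using (0ℓ)
open import Data.Nat as ℕ using (ℕ; zero; suc)
open import Data.Fin using (Fin)
open import Data.Vec using (Vec; []; _∷_; zipWith; replicate; lookup; toList; reverse)
open import Data.Vec.Properties using (≡-dec)
open import Data.List using (List; []; _∷_; _++_; map; concatMap; foldr; tabulate)
open import Data.Product using (_×_; _,_; ∃; Σ)
open import Data.Sum using (_⊎_)
open import Data.Empty using (⊥)
open import Relation.Nullary using (¬_; yes; no)
open import Relation.Binary.PropositionalEquality using (_≡_)

import Algebra.Structures as AS

-- The real numbers: an abstract Dedekind-complete ordered field.
-- (agda-stdlib has no reals; every model of this record is ℝ up to
--  isomorphism.)

record RealField : Set₁ where
  field
    ℝ   : Set
    _+_ _*_ : ℝ → ℝ → ℝ
    -_  : ℝ → ℝ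
    0r 1r : ℝ
    isCommutativeRing : AS.IsCommutativeRing {A = ℝ} _≡_ _+_ _*_ -_ 0r 1r
    0≢1 : ¬ (0r ≡ 1r)
    _⁻¹ : ℝ → ℝ
    ⁻¹-inverse : ∀ x → ¬ (x ≡ 0r) → (x * (x ⁻¹)) ≡ 1r
    _<_ : ℝ → ℝ → Set
    <-irrefl : ∀ x → ¬ (x < x)
    <-trans : ∀ {x y z} → x < y → y < z → x < z
    <-trichotomy : ∀ x y → x < y ⊎ (x ≡ y ⊎ y < x)
    +-mono-< : ∀ {x y} z → x < y → (x + z) < (y + z)
    *-pos : ∀ {x y} → 0r < x → 0r < y → 0r < (x * y)
  _≤_ : ℝ → ℝ → Set
  x ≤ y = x < y ⊎ x ≡ y
  field
    sup : (S : ℝ → Set) → (∃ λ x → S x) → (∃ λ b → ∀ x → S x → x ≤ b) →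
          ∃ λ u → (∀ x → S x → x ≤ u) × (∀ b → (∀ x → S x → x ≤ b) → u ≤ b)

module Poly (R : RealField) where
  open RealField R

  fromℕ : ℕ → ℝ
  fromℕ zero = 0r
  fromℕ (suc n) = 1r + fromℕ n

  sumℝ : List ℝ → ℝ
  sumℝ = foldr _+_ 0r

  -- A polynomial in m variables over ℝ, given as a finite formal sum of
  -- terms (coefficient, exponent vector). Different lists may denote the
  -- same polynomial; the polynomial itself is determined by `coeff`.
  Poly : ℕ → Set
  Poly m = List (ℝ × Vec ℕ m)

  coeff : ∀ {m} → Poly m → Vec ℕ m → ℝ
  coeff [] α = 0r
  coeff ((c , β) ∷ p) α with ≡-dec ℕ._≟_ β α
  ... | yes _ = c + coeff p α
  ... | no  _ = coeff p α

  const : ∀ {m} → ℝ → Poly m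
  const c = (c , replicate _ 0) ∷ []

  _⊕_ : ∀ {m} → Poly m → Poly m → Poly m
  p ⊕ q = p ++ q

  _⊗_ : ∀ {m} → Poly m → Poly m → Poly m
  p ⊗ q = concatMap (λ { (c , α) → map (λ { (d , β) → (c * d , zipWith ℕ._+_ α β) }) q }) p

  _^ᵖ_ : ∀ {m} → Poly m → ℕ → Poly m
  p ^ᵖ zero = const 1r
  p ^ᵖ suc k = p ⊗ (p ^ᵖ k)

  monoEval : ∀ {m s} → Vec (Poly m) s → Vec ℕ s → Poly m
  monoEval [] [] = const 1r
  monoEval (g ∷ gs) (e ∷ es) = (g ^ᵖ e) ⊗ monoEval gs es

  subst : ∀ {m s} → Poly s → Vec (Poly m) s → Poly m
  subst [] gs = []
  subst ((c , e) ∷ P) gs = (const c ⊗ monoEval gs e) ⊕ subst P gs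

  data _<lex_ : List ℕ → List ℕ → Set where
    here  : ∀ {a b as bs} → a ℕ.< b → (a ∷ as) <lex (b ∷ bs)
    there : ∀ {a as bs} → as <lex bs → (a ∷ as) <lex (a ∷ bs)

  -- The term order of the paper on exponent vectors
  -- (i_1,…,i_{n1},j_1,…,j_{n2}): compare j_{n2} first, then j_{n2-1},
  -- …, j_1, then i_{n1}, …, i_1; i.e. lex order on the reversed vector.
  _≺_ : ∀ {m} → Vec ℕ m → Vec ℕ m → Set
  α ≺ β = toList (reverse α) <lex toList (reverse β)

  LeastExponent : ∀ {m} → Poly m → Vec ℕ m → Set
  LeastExponent p α =
    ¬ (coeff p α ≡ 0r) × (∀ β → ¬ (coeff p β ≡ 0r) → β ≡ α ⊎ α ≺ β)

  LinearlyIndependent : ∀ {k m} → (Fin k → Vec ℕ m) → Set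
  LinearlyIndependent {k} {m} v =
    (c : Fin k → ℝ) →
    (∀ (j : Fin m) → sumℝ (tabulate (λ i → c i * fromℕ (lookup (v i) j))) ≡ 0r) →
    ∀ i → c i ≡ 0r

-- If k > s, the polynomials bᵢ = P (σ i) in s variables are algebraically dependent:
-- with d a bound on their degrees in each variable, the D^k products b^e with
-- e ∈ {0,…,D−1}^k have degree at most kDd in each variable, so for D large they
-- outnumber the (kDd+1)^s monomials available and satisfy a nontrivial linear
-- relation Σ c_e b^e = 0.  Substituting g turns it into Σ c_e a^e = 0 for
-- aᵢ = bᵢ(g).  The least exponent of a^e is Σ eᵢ αᵢ, and these are pairwise
-- distinct because the αᵢ are linearly independent; so the term with the least
-- such exponent among the c_e ≠ 0 cannot cancel.

module Submission where

open import Defs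
open import Level using (Level; 0ℓ)
open import Algebra.Bundles using (CommutativeRing)
open import Data.Fin using (Fin; zero; suc; punchIn; toℕ; fromℕ<; finToFun; funToFin; combine)
open import Data.Fin.Properties using
  (all?; any?; ¬∀⟶∃¬; punchInᵢ≢i; toℕ<n; toℕ-fromℕ<; toℕ-injective; finToFun-funToFin; funToFin-finToFin)
open import Data.List using ([]; _∷_; _++_; length; map; concatMap; tabulate)
open import Data.List.Relation.Unary.All as All using (All; []; _∷_)
open import Data.List.Relation.Unary.All.Properties using (map⁺; concat⁺)
open import Data.Nat as ℕ using (ℕ; zero; suc)
import Data.Nat.Properties as ℕₚ
open import Algebra.Properties.CommutativeSemigroup ℕₚ.*-commutativeSemigroup using ()
  renaming (interchange to *-interchange)
open import Data.Product using (∃; ∃-syntax; _×_; _,_; proj₁; proj₂)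
open import Data.Sum using (_⊎_; inj₁; inj₂)
open import Data.Vec as Vec using (Vec; []; _∷_; _∷ʳ_; zipWith; replicate; reverse; toList; lookup)
open import Data.Vec.Properties using
  ( ≡-dec; reverse-∷; reverse-injective; ∷-injectiveˡ; ∷-injectiveʳ
  ; zipWith-comm; zipWith-assoc; zipWith-identityˡ; lookup-zipWith; lookup-replicate
  ; tabulate-cong; tabulate∘lookup )
open import Data.Vec.Relation.Unary.All as VecAll using ([]; _∷_)
open import Data.Vec.Relation.Unary.All.Properties using (lookup⁺)
open import Data.Vec.Functional using (insertAt)
open import Data.Vec.Functional.Properties using (insertAt-lookup; insertAt-punchIn)
open import Function using (_∘_; case_of_)
open import Relation.Binary.Bundles using (TotalPreorder)
open import Relation.Binary.Definitions using (tri<; tri≈; tri>)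
open import Relation.Binary.PropositionalEquality as ≡
  using (_≡_; _≢_; refl; sym; trans; cong; cong₂; _≗_; module ≡-Reasoning)
open import Relation.Nullary using (Dec; yes; no; ¬_; ¬?; contradiction)
open import Relation.Unary using (Pred; Decidable)

module _ {a ℓ₁ ℓ₂ : Level} (O : TotalPreorder a ℓ₁ ℓ₂) where
  open TotalPreorder O using (_≲_; total) renaming (Carrier to A; refl to ≲-refl; trans to ≲-trans)

  minimiser : ∀ {M p} (P : Pred (Fin M) p) → Decidable P → (f : Fin M → A) → ∃ P →
              ∃[ i ] P i × (∀ j → P j → f i ≲ f j)
  minimiser {suc M} P P? f ∃P with any? (P? ∘ suc)
  ... | no ¬∃Psuc = zero , P-zero ∃P , λ
      { zero    _  → ≲-refl
      ; (suc j) Pj → contradiction (j , Pj) ¬∃Psuc }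
    where
    P-zero : ∃ P → P zero
    P-zero (zero  , P0) = P0
    P-zero (suc j , Pj) = contradiction (j , Pj) ¬∃Psuc
  ... | yes ∃Psuc with minimiser (P ∘ suc) (P? ∘ suc) (f ∘ suc) ∃Psuc
  ...   | i , Pi , minimal with P? zero
  ...     | no ¬P0 = suc i , Pi , λ
            { zero    P0 → contradiction P0 ¬P0
            ; (suc j) Pj → minimal j Pj }
  ...     | yes P0 with total (f zero) (f (suc i))
  ...       | inj₁ f0≲fi = zero , P0 , λ
              { zero    _  → ≲-refl
              ; (suc j) Pj → ≲-trans f0≲fi (minimal j Pj) }
  ...       | inj₂ fi≲f0 = suc i , Pi , λ
              { zero    _  → fi≲f0
              ; (suc j) Pj → minimal j Pj }

^-distribʳ-* : ∀ m n o → (m ℕ.* n) ℕ.^ o ≡ m ℕ.^ o ℕ.* n ℕ.^ o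
^-distribʳ-* m n zero    = refl
^-distribʳ-* m n (suc o) = trans (cong (m ℕ.* n ℕ.*_) (^-distribʳ-* m n o)) (*-interchange m n _ _)

power-outgrows : ∀ {s k} → s ℕ.< k → ∀ d → ∃[ D ] suc (k ℕ.* (D ℕ.* d)) ℕ.^ s ℕ.< D ℕ.^ k
power-outgrows {s} {k} s<k d = D , (begin-strict
  suc (k ℕ.* (D ℕ.* d)) ℕ.^ s  ≤⟨ ℕₚ.^-monoˡ-≤ s linear ⟩
  (C ℕ.* D) ℕ.^ s              ≡⟨ ^-distribʳ-* C D s ⟩
  C ℕ.^ s ℕ.* D ℕ.^ s          <⟨ ℕₚ.*-monoˡ-< (D ℕ.^ s) {{ℕₚ.m^n≢0 D s}} (ℕₚ.n<1+n (C ℕ.^ s)) ⟩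
  D ℕ.* D ℕ.^ s                ≤⟨ ℕₚ.^-monoʳ-≤ D s<k ⟩
  D ℕ.^ k                      ∎)
  where
  open ℕₚ.≤-Reasoning
  C = suc (k ℕ.* d)
  D = suc (C ℕ.^ s)
  linear : suc (k ℕ.* (D ℕ.* d)) ℕ.≤ C ℕ.* D
  linear = ℕₚ.+-mono-≤ (ℕ.s≤s ℕ.z≤n)
    (ℕₚ.≤-reflexive (trans (cong (k ℕ.*_) (ℕₚ.*-comm D d)) (sym (ℕₚ.*-assoc k d D))))

funToFin-cong : ∀ {m n} {f g : Fin m → Fin n} → f ≗ g → funToFin f ≡ funToFin g
funToFin-cong {zero}  _    = refl
funToFin-cong {suc m} f≗g = cong₂ combine (f≗g zero) (funToFin-cong (f≗g ∘ suc))

finToFun-injective : ∀ {m n} {i j : Fin (m ℕ.^ n)} → finToFun {m} {n} i ≗ finToFun j → i ≡ j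
finToFun-injective {m} {n} {i} {j} i≗j = begin
  i                                      ≡⟨ funToFin-finToFin {n} {m} i ⟨
  funToFin {n} {m} (finToFun {m} {n} i)  ≡⟨ funToFin-cong i≗j ⟩
  funToFin {n} {m} (finToFun {m} {n} j)  ≡⟨ funToFin-finToFin {n} {m} j ⟩
  j                                      ∎
  where open ≡-Reasoning

zipWith-∷ʳ : ∀ {A B C : Set} (f : A → B → C) {n} (xs : Vec A n) ys x y →
             zipWith f (xs ∷ʳ x) (ys ∷ʳ y) ≡ zipWith f xs ys ∷ʳ f x y
zipWith-∷ʳ f []       []       x y = refl
zipWith-∷ʳ f (x′ ∷ xs) (y′ ∷ ys) x y = cong (f x′ y′ ∷_) (zipWith-∷ʳ f xs ys x y)

reverse-zipWith : ∀ {A B C : Set} (f : A → B → C) {n} (xs : Vec A n) ys →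
                  reverse (zipWith f xs ys) ≡ zipWith f (reverse xs) (reverse ys)
reverse-zipWith f []       []       = refl
reverse-zipWith f (x ∷ xs) (y ∷ ys) = begin
  reverse (f x y ∷ zipWith f xs ys)                  ≡⟨ reverse-∷ (f x y) (zipWith f xs ys) ⟩
  reverse (zipWith f xs ys) ∷ʳ f x y                 ≡⟨ cong (_∷ʳ f x y) (reverse-zipWith f xs ys) ⟩
  zipWith f (reverse xs) (reverse ys) ∷ʳ f x y       ≡⟨ zipWith-∷ʳ f (reverse xs) (reverse ys) x y ⟨
  zipWith f (reverse xs ∷ʳ x) (reverse ys ∷ʳ y)      ≡⟨ cong₂ (zipWith f) (reverse-∷ x xs) (reverse-∷ y ys) ⟨
  zipWith f (reverse (x ∷ xs)) (reverse (y ∷ ys))    ∎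
  where open ≡-Reasoning

module _ (R : RealField) where
  open RealField R renaming
    (_+_ to infixl 6 _+_; _*_ to infixl 7 _*_; -_ to infix 8 -_; _<_ to infix 4 _<_)
  open Poly R

  commutativeRing : CommutativeRing 0ℓ 0ℓ
  commutativeRing = record { isCommutativeRing = isCommutativeRing }

  open CommutativeRing commutativeRing using
    ( +-identityˡ; +-identityʳ; *-identityˡ; *-identityʳ; zeroˡ; zeroʳ
    ; +-comm; *-comm; +-assoc; *-assoc; distribˡ; distribʳ; -‿inverseˡ; -‿inverseʳ
    ; ring; semiring; +-monoid; +-commutativeMonoid; +-commutativeSemigroup; *-commutativeSemigroup )
  open import Algebra.Properties.Ring ring using
    (-‿distribˡ-*; -‿distribʳ-*; -‿+-comm; -‿involutive; x∙y⁻¹≈ε⇒x≈y; +-cancelˡ; -0#≈0#)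
  open import Algebra.Properties.CommutativeSemigroup +-commutativeSemigroup using ()
    renaming (interchange to +-interchange; x∙yz≈y∙xz to x+[y+z]≡y+[x+z])
  open import Algebra.Properties.CommutativeSemigroup *-commutativeSemigroup using ()
    renaming (x∙yz≈y∙xz to x*[y*z]≡y*[x*z])
  open import Algebra.Properties.CommutativeMonoid.Sum +-commutativeMonoid using
    (sum; sum-remove; ∑-distrib-+; sum-cong-≗; sum-replicate-zero)
  open import Algebra.Properties.Semiring.Sum semiring using (*-distribˡ-sum; *-distribʳ-sum)
  open import Algebra.Properties.Monoid.Mult +-monoid using (×-homo-+) renaming (_×_ to _·_)
  open import Algebra.Properties.Semiring.Mult semiring using (×1-homo-*)
  open ≡-Reasoning

  _≟_ : (x y : ℝ) → Dec (x ≡ y)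
  x ≟ y with <-trichotomy x y
  ... | inj₁ x<y        = no λ { refl → <-irrefl x x<y }
  ... | inj₂ (inj₁ x≡y) = yes x≡y
  ... | inj₂ (inj₂ y<x) = no λ { refl → <-irrefl x y<x }

  1≢0 : 1r ≢ 0r
  1≢0 = 0≢1 ∘ sym

  *-≢0 : ∀ {x y} → x ≢ 0r → y ≢ 0r → x * y ≢ 0r
  *-≢0 {x} {y} x≢0 y≢0 xy≡0 = y≢0 (begin
    y                ≡⟨ sym (*-identityˡ y) ⟩
    1r * y           ≡⟨ cong (_* y) (trans (sym (⁻¹-inverse x x≢0)) (*-comm x (x ⁻¹))) ⟩
    x ⁻¹ * x * y     ≡⟨ *-assoc (x ⁻¹) x y ⟩
    x ⁻¹ * (x * y)   ≡⟨ cong (x ⁻¹ *_) xy≡0 ⟩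
    x ⁻¹ * 0r        ≡⟨ zeroʳ (x ⁻¹) ⟩
    0r               ∎)

  *-vanishes : ∀ {x y} → (x ≢ 0r → y ≡ 0r) → x * y ≡ 0r
  *-vanishes {x} {y} y≡0 with x ≟ 0r
  ... | yes x≡0 = trans (cong (_* y) x≡0) (zeroˡ y)
  ... | no x≢0  = trans (cong (x *_) (y≡0 x≢0)) (zeroʳ x)

  ≢0-stable : ∀ {x} → ¬ x ≢ 0r → x ≡ 0r
  ≢0-stable {x} ¬x≢0 with x ≟ 0r
  ... | yes x≡0 = x≡0
  ... | no x≢0  = contradiction x≢0 ¬x≢0

  0<1 : 0r < 1r
  0<1 with <-trichotomy 0r 1r
  ... | inj₁ 0<1        = 0<1
  ... | inj₂ (inj₁ 0≡1) = contradiction 0≡1 0≢1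
  ... | inj₂ (inj₂ 1<0) = contradiction (<-trans 0<1′ 1<0) (<-irrefl 0r)
    where
    0<-1 : 0r < - 1r
    0<-1 = ≡.subst₂ _<_ (-‿inverseʳ 1r) (+-identityˡ (- 1r)) (+-mono-< (- 1r) 1<0)
    -1*-1≡1 : - 1r * - 1r ≡ 1r
    -1*-1≡1 = trans (sym (-‿distribˡ-* 1r (- 1r))) (trans (cong -_ (*-identityˡ (- 1r))) (-‿involutive 1r))
    0<1′ : 0r < 1r
    0<1′ = ≡.subst (0r <_) -1*-1≡1 (*-pos 0<-1 0<-1)

  fromℕ≡·1 : ∀ n → fromℕ n ≡ n · 1r
  fromℕ≡·1 zero    = refl
  fromℕ≡·1 (suc n) = cong (1r +_) (fromℕ≡·1 n)

  fromℕ-+ : ∀ m n → fromℕ (m ℕ.+ n) ≡ fromℕ m + fromℕ n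
  fromℕ-+ m n = begin
    fromℕ (m ℕ.+ n)       ≡⟨ fromℕ≡·1 (m ℕ.+ n) ⟩
    (m ℕ.+ n) · 1r        ≡⟨ ×-homo-+ 1r m n ⟩
    m · 1r + n · 1r       ≡⟨ cong₂ _+_ (fromℕ≡·1 m) (fromℕ≡·1 n) ⟨
    fromℕ m + fromℕ n     ∎

  fromℕ-* : ∀ m n → fromℕ (m ℕ.* n) ≡ fromℕ m * fromℕ n
  fromℕ-* m n = begin
    fromℕ (m ℕ.* n)       ≡⟨ fromℕ≡·1 (m ℕ.* n) ⟩
    (m ℕ.* n) · 1r        ≡⟨ ×1-homo-* m n ⟩
    m · 1r * n · 1r       ≡⟨ cong₂ _*_ (fromℕ≡·1 m) (fromℕ≡·1 n) ⟨
    fromℕ m * fromℕ n     ∎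

  0<fromℕ-suc : ∀ n → 0r < fromℕ (suc n)
  0<fromℕ-suc zero    = ≡.subst (0r <_) (sym (+-identityʳ 1r)) 0<1
  0<fromℕ-suc (suc n) = <-trans 0<1
    (≡.subst₂ _<_ (+-identityˡ 1r) (+-comm _ 1r) (+-mono-< 1r (0<fromℕ-suc n)))

  fromℕ-injective : ∀ m n → fromℕ m ≡ fromℕ n → m ≡ n
  fromℕ-injective zero    zero    _  = refl
  fromℕ-injective zero    (suc n) eq = contradiction (≡.subst (0r <_) (sym eq) (0<fromℕ-suc n)) (<-irrefl 0r)
  fromℕ-injective (suc m) zero    eq = contradiction (≡.subst (0r <_) eq (0<fromℕ-suc m)) (<-irrefl 0r)
  fromℕ-injective (suc m) (suc n) eq = cong suc (fromℕ-injective m n (+-cancelˡ 1r _ _ eq))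

  -- Finite sums and linear dependence

  sumℝ-tabulate : ∀ {n} (f : Fin n → ℝ) → sumℝ (tabulate f) ≡ sum f
  sumℝ-tabulate {zero}  f = refl
  sumℝ-tabulate {suc n} f = cong (f zero +_) (sumℝ-tabulate (f ∘ suc))

  sum-zero : ∀ {n} (f : Fin n → ℝ) → (∀ i → f i ≡ 0r) → sum f ≡ 0r
  sum-zero {n} f f≡0 = trans (sum-cong-≗ f≡0) (sum-replicate-zero n)

  sum-concentrated : ∀ {n} (f : Fin n → ℝ) i → (∀ j → j ≢ i → f j ≡ 0r) → sum f ≡ f i
  sum-concentrated {suc n} f i f≡0 = begin
    sum f                      ≡⟨ sum-remove {i = i} f ⟩
    f i + sum (f ∘ punchIn i)  ≡⟨ cong (f i +_) (sum-zero _ λ j → f≡0 (punchIn i j) (punchInᵢ≢i i j)) ⟩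
    f i + 0r                   ≡⟨ +-identityʳ (f i) ⟩
    f i                        ∎

  sum-neg : ∀ {n} (f : Fin n → ℝ) → sum (λ i → - f i) ≡ - sum f
  sum-neg {zero}  f = sym -0#≈0#
  sum-neg {suc n} f = trans (cong (- f zero +_) (sum-neg (f ∘ suc))) (-‿+-comm (f zero) (sum (f ∘ suc)))

  LinearRelation : ∀ {M} {J : Set} → (Fin M → J → ℝ) → (Fin M → ℝ) → Set
  LinearRelation v c = ∀ j → sum (λ i → c i * v i j) ≡ 0r

  Nontrivial : ∀ {M} → (Fin M → ℝ) → Set
  Nontrivial c = ∃[ i ] c i ≢ 0r

  -- Fraction-free elimination of the first coordinate against the pivot row i₀:
  -- row i becomes v i₀ 0 · v i − v i 0 · v i₀, with its (zero) first entry dropped.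
  eliminate : ∀ {M n} → (Fin (suc M) → Fin (suc n) → ℝ) → Fin (suc M) → Fin M → Fin n → ℝ
  eliminate v i₀ i j = v i₀ zero * v (punchIn i₀ i) (suc j) + - (v (punchIn i₀ i) zero * v i₀ (suc j))

  unEliminate : ∀ {M n} → (Fin (suc M) → Fin (suc n) → ℝ) → Fin (suc M) → (Fin M → ℝ) → Fin (suc M) → ℝ
  unEliminate v i₀ d = insertAt (λ i → v i₀ zero * d i) i₀ (- sum (λ i → d i * v (punchIn i₀ i) zero))

  LinearRelation-unEliminate : ∀ {M n} (v : Fin (suc M) → Fin (suc n) → ℝ) i₀ (d : Fin M → ℝ) →
    LinearRelation (eliminate v i₀) d → LinearRelation v (unEliminate v i₀ d)
  LinearRelation-unEliminate v i₀ d relation j = begin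
    sum (λ i → c i * v i j)                   ≡⟨ sum-remove {i = i₀} (λ i → c i * v i j) ⟩
    c i₀ * v i₀ j + sum (λ i → c (punchIn i₀ i) * w i j)
      ≡⟨ cong₂ _+_ (cong (_* v i₀ j) (insertAt-lookup _ i₀ _))
                   (sum-cong-≗ λ i → trans (cong (_* w i j) (insertAt-punchIn _ i₀ _ i)) (*-assoc p (d i) (w i j))) ⟩
    - A * v i₀ j + sum (λ i → p * (d i * w i j)) ≡⟨ cong (- A * v i₀ j +_) (*-distribˡ-sum p (S j)) ⟨
    - A * v i₀ j + p * sum (S j)              ≡⟨ cong (- A * v i₀ j +_) (proportional j) ⟩
    - A * v i₀ j + A * v i₀ j
      ≡⟨ trans (cong (_+ A * v i₀ j) (sym (-‿distribˡ-* A (v i₀ j)))) (-‿inverseˡ _) ⟩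
    0r                                        ∎
    where
    p = v i₀ zero
    w = v ∘ punchIn i₀
    c = unEliminate v i₀ d
    S : Fin _ → Fin _ → ℝ
    S j i = d i * w i j
    A = sum (S zero)
    -- The reduced relation says that Σ dᵢ ⋅ (row punchIn i₀ i) is proportional to row i₀.
    proportional : ∀ j → p * sum (S j) ≡ A * v i₀ j
    proportional zero    = *-comm p A
    proportional (suc j) = x∙y⁻¹≈ε⇒x≈y _ _ (begin
      p * sum (S (suc j)) + - (A * u)
        ≡⟨ cong₂ _+_ (*-distribˡ-sum p (S (suc j)))
                     (trans (cong -_ (*-distribʳ-sum u (S zero))) (sym (sum-neg (λ i → S zero i * u)))) ⟩
      sum (λ i → p * S (suc j) i) + sum (λ i → - (S zero i * u))
        ≡⟨ ∑-distrib-+ (λ i → p * S (suc j) i) (λ i → - (S zero i * u)) ⟨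
      sum (λ i → p * S (suc j) i + - (S zero i * u))
        ≡⟨ sum-cong-≗ (λ i → expand (d i) (w i (suc j)) (w i zero)) ⟨
      sum (λ i → d i * eliminate v i₀ i j)                     ≡⟨ relation j ⟩
      0r                                                       ∎)
      where
      u = v i₀ (suc j)
      expand : ∀ x a b → x * (p * a + - (b * u)) ≡ p * (x * a) + - (x * b * u)
      expand x a b = begin
        x * (p * a + - (b * u))         ≡⟨ distribˡ x (p * a) (- (b * u)) ⟩
        x * (p * a) + x * - (b * u)     ≡⟨ cong₂ _+_ (x*[y*z]≡y*[x*z] x p a) (sym (-‿distribʳ-* x (b * u))) ⟩
        p * (x * a) + - (x * (b * u))   ≡⟨ cong (λ t → p * (x * a) + - t) (*-assoc x b u) ⟨
        p * (x * a) + - (x * b * u)     ∎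

  linearDependence : ∀ {n M} → n ℕ.< M → (v : Fin M → Fin n → ℝ) →
                     ∃[ c ] Nontrivial c × LinearRelation v c
  linearDependence {zero} {suc M} _ v = (λ _ → 1r) , (zero , 1≢0) , λ ()
  linearDependence {suc n} {M} n<M v with all? (λ i → v i zero ≟ 0r)
  ... | yes column₀≡0 with linearDependence (ℕₚ.<-trans (ℕₚ.n<1+n n) n<M) (λ i j → v i (suc j))
  ...   | c , nontrivial , relation = c , nontrivial , λ
          { zero    → sum-zero _ λ i → trans (cong (c i *_) (column₀≡0 i)) (zeroʳ (c i))
          ; (suc j) → relation j }
  linearDependence {suc n} {suc M} (ℕ.s≤s n<M) v | no ¬column₀≡0
    with ¬∀⟶∃¬ (suc M) _ (λ i → v i zero ≟ 0r) ¬column₀≡0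
  ... | i₀ , pivot≢0 with linearDependence n<M (eliminate v i₀)
  ...   | d , (i₁ , d≢0) , relation =
          unEliminate v i₀ d
            , (punchIn i₀ i₁ , λ c≡0 → *-≢0 pivot≢0 d≢0 (trans (sym (insertAt-punchIn _ i₀ _ i₁)) c≡0))
            , LinearRelation-unEliminate v i₀ d relation

  -- Exponent vectors and the term order

  Exp : ℕ → Set
  Exp m = Vec ℕ m

  private variable m : ℕ

  infixl 6 _⊹_
  _⊹_ : Exp m → Exp m → Exp m
  _⊹_ = zipWith ℕ._+_

  𝟘 : Exp m
  𝟘 = replicate _ 0

  ⊹-comm : (α β : Exp m) → α ⊹ β ≡ β ⊹ α
  ⊹-comm = zipWith-comm ℕₚ.+-comm

  ⊹-assoc : (α β γ : Exp m) → α ⊹ β ⊹ γ ≡ α ⊹ (β ⊹ γ)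
  ⊹-assoc = zipWith-assoc ℕₚ.+-assoc

  ⊹-identityˡ : (α : Exp m) → 𝟘 ⊹ α ≡ α
  ⊹-identityˡ = zipWith-identityˡ ℕₚ.+-identityˡ

  ⊹-cancelˡ : (α β γ : Exp m) → α ⊹ β ≡ α ⊹ γ → β ≡ γ
  ⊹-cancelˡ []      []      []      _  = refl
  ⊹-cancelˡ (a ∷ α) (b ∷ β) (c ∷ γ) eq =
    cong₂ _∷_ (ℕₚ.+-cancelˡ-≡ a b c (∷-injectiveˡ eq)) (⊹-cancelˡ α β γ (∷-injectiveʳ eq))

  -- Same recursion as _^ᵖ_, so that the least exponent of p ^ᵖ n is n ·ᵉ α on the nose.
  infixr 7 _·ᵉ_
  _·ᵉ_ : ℕ → Exp m → Exp m
  zero  ·ᵉ α = 𝟘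
  suc n ·ᵉ α = α ⊹ n ·ᵉ α

  weightedSum : ∀ {k} → (Fin k → ℕ) → (Fin k → Exp m) → Exp m
  weightedSum {k = zero}  e α = 𝟘
  weightedSum {k = suc k} e α = e zero ·ᵉ α zero ⊹ weightedSum (e ∘ suc) (α ∘ suc)

  lookup-·ᵉ : ∀ n (α : Exp m) j → lookup (n ·ᵉ α) j ≡ n ℕ.* lookup α j
  lookup-·ᵉ zero    α j = lookup-replicate j 0
  lookup-·ᵉ (suc n) α j = trans (lookup-zipWith ℕ._+_ j α (n ·ᵉ α)) (cong (lookup α j ℕ.+_) (lookup-·ᵉ n α j))

  fromℕ-weightedSum : ∀ {k} (e : Fin k → ℕ) (α : Fin k → Exp m) j →
                      fromℕ (lookup (weightedSum e α) j) ≡ sum (λ i → fromℕ (e i) * fromℕ (lookup (α i) j))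
  fromℕ-weightedSum {k = zero}  e α j = cong fromℕ (lookup-replicate j 0)
  fromℕ-weightedSum {k = suc k} e α j = begin
    fromℕ (lookup (e zero ·ᵉ α zero ⊹ rest) j)
      ≡⟨ cong fromℕ (lookup-zipWith ℕ._+_ j (e zero ·ᵉ α zero) rest) ⟩
    fromℕ (lookup (e zero ·ᵉ α zero) j ℕ.+ lookup rest j)
      ≡⟨ fromℕ-+ (lookup (e zero ·ᵉ α zero) j) (lookup rest j) ⟩
    fromℕ (lookup (e zero ·ᵉ α zero) j) + fromℕ (lookup rest j)
      ≡⟨ cong₂ _+_ (trans (cong fromℕ (lookup-·ᵉ (e zero) (α zero) j)) (fromℕ-* (e zero) (lookup (α zero) j)))
                   (fromℕ-weightedSum (e ∘ suc) (α ∘ suc) j) ⟩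
    sum (λ i → fromℕ (e i) * fromℕ (lookup (α i) j))          ∎
    where rest = weightedSum (e ∘ suc) (α ∘ suc)

  weightedSum-injective : ∀ {k} {α : Fin k → Exp m} → LinearlyIndependent α →
                          ∀ {e e′} → weightedSum e α ≡ weightedSum e′ α → e ≗ e′
  weightedSum-injective {k = k} {α = α} independent {e} {e′} eq i =
    fromℕ-injective _ _ (x∙y⁻¹≈ε⇒x≈y _ _ (independent c relation i))
    where
    c : Fin k → ℝ
    c i = fromℕ (e i) + - fromℕ (e′ i)
    A : Fin k → Fin _ → ℝ
    A i j = fromℕ (lookup (α i) j)
    relation : ∀ j → sumℝ (tabulate (λ i → c i * A i j)) ≡ 0r
    relation j = begin
      sumℝ (tabulate (λ i → c i * A i j))
        ≡⟨ sumℝ-tabulate (λ i → c i * A i j) ⟩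
      sum (λ i → c i * A i j)
        ≡⟨ sum-cong-≗ (λ i → distribʳ (A i j) _ _) ⟩
      sum (λ i → fromℕ (e i) * A i j + - fromℕ (e′ i) * A i j)
        ≡⟨ ∑-distrib-+ (λ i → fromℕ (e i) * A i j) (λ i → - fromℕ (e′ i) * A i j) ⟩
      sum (λ i → fromℕ (e i) * A i j) + sum (λ i → - fromℕ (e′ i) * A i j)
        ≡⟨ cong (sum (λ i → fromℕ (e i) * A i j) +_)
             (trans (sum-cong-≗ (λ i → sym (-‿distribˡ-* (fromℕ (e′ i)) (A i j)))) (sum-neg (λ i → fromℕ (e′ i) * A i j))) ⟩
      sum (λ i → fromℕ (e i) * A i j) + - sum (λ i → fromℕ (e′ i) * A i j)
        ≡⟨ cong₂ (λ x y → x + - y) (fromℕ-weightedSum e α j) (fromℕ-weightedSum e′ α j) ⟨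
      fromℕ (lookup (weightedSum e α) j) + - fromℕ (lookup (weightedSum e′ α) j)
        ≡⟨ cong (λ v → fromℕ (lookup v j) + - fromℕ (lookup (weightedSum e′ α) j)) eq ⟩
      fromℕ (lookup (weightedSum e′ α) j) + - fromℕ (lookup (weightedSum e′ α) j)  ≡⟨ -‿inverseʳ _ ⟩
      0r                                                                          ∎

  <lex-irrefl : ∀ xs → ¬ xs <lex xs
  <lex-irrefl (x ∷ xs) (here x<x)   = ℕₚ.<-irrefl refl x<x
  <lex-irrefl (x ∷ xs) (there xs<xs) = <lex-irrefl xs xs<xs

  <lex-trans : ∀ {xs ys zs} → xs <lex ys → ys <lex zs → xs <lex zs
  <lex-trans (here x<y)  (here y<z)  = here (ℕₚ.<-trans x<y y<z)
  <lex-trans (here x<y)  (there _)   = here x<y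
  <lex-trans (there _)   (here y<z)  = here y<z
  <lex-trans (there p)   (there q)   = there (<lex-trans p q)

  <lex-trichotomy : (α β : Exp m) → toList α <lex toList β ⊎ α ≡ β ⊎ toList β <lex toList α
  <lex-trichotomy []      []      = inj₂ (inj₁ refl)
  <lex-trichotomy (a ∷ α) (b ∷ β) with ℕₚ.<-cmp a b
  ... | tri< a<b _ _ = inj₁ (here a<b)
  ... | tri> _ _ b<a = inj₂ (inj₂ (here b<a))
  ... | tri≈ _ refl _ with <lex-trichotomy α β
  ...   | inj₁ α<β        = inj₁ (there α<β)
  ...   | inj₂ (inj₁ refl) = inj₂ (inj₁ refl)
  ...   | inj₂ (inj₂ β<α) = inj₂ (inj₂ (there β<α))

  <lex-⊹-monoˡ : (α β γ : Exp m) → toList α <lex toList β → toList (α ⊹ γ) <lex toList (β ⊹ γ)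
  <lex-⊹-monoˡ (a ∷ α) (b ∷ β)  (c ∷ γ) (here a<b)  = here (ℕₚ.+-monoˡ-< c a<b)
  <lex-⊹-monoˡ (a ∷ α) (.a ∷ β) (c ∷ γ) (there α<β) = there (<lex-⊹-monoˡ α β γ α<β)

  -- α ≺ β unfolds to a statement about reversed lists, from which α and β
  -- cannot be inferred; wrapping it in a record makes them inferable.
  infix 4 _⊏_ _≼_
  record _⊏_ (α β : Exp m) : Set where
    constructor mk⊏
    field ≺-witness : α ≺ β

  ⊏-irrefl : (α : Exp m) → ¬ α ⊏ α
  ⊏-irrefl α (mk⊏ α≺α) = <lex-irrefl _ α≺α

  ⊏-trans : {α β γ : Exp m} → α ⊏ β → β ⊏ γ → α ⊏ γ
  ⊏-trans (mk⊏ α≺β) (mk⊏ β≺γ) = mk⊏ (<lex-trans α≺β β≺γ)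

  ⊏-trichotomy : (α β : Exp m) → α ⊏ β ⊎ α ≡ β ⊎ β ⊏ α
  ⊏-trichotomy α β with <lex-trichotomy (reverse α) (reverse β)
  ... | inj₁ α≺β        = inj₁ (mk⊏ α≺β)
  ... | inj₂ (inj₁ eq)  = inj₂ (inj₁ (reverse-injective eq))
  ... | inj₂ (inj₂ β≺α) = inj₂ (inj₂ (mk⊏ β≺α))

  ⊹-monoˡ-⊏ : {α β : Exp m} (γ : Exp m) → α ⊏ β → α ⊹ γ ⊏ β ⊹ γ
  ⊹-monoˡ-⊏ {α = α} {β} γ (mk⊏ α≺β) = mk⊏ (≡.subst₂ (λ x y → toList x <lex toList y)
    (sym (reverse-zipWith ℕ._+_ α γ)) (sym (reverse-zipWith ℕ._+_ β γ))
    (<lex-⊹-monoˡ (reverse α) (reverse β) (reverse γ) α≺β))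

  ⊹-monoʳ-⊏ : {α β : Exp m} (γ : Exp m) → α ⊏ β → γ ⊹ α ⊏ γ ⊹ β
  ⊹-monoʳ-⊏ {α = α} {β} γ α⊏β = ≡.subst₂ _⊏_ (⊹-comm α γ) (⊹-comm β γ) (⊹-monoˡ-⊏ γ α⊏β)

  _≼_ : Exp m → Exp m → Set
  α ≼ β = α ≡ β ⊎ α ⊏ β

  ≼-trans : {α β γ : Exp m} → α ≼ β → β ≼ γ → α ≼ γ
  ≼-trans (inj₁ refl) β≼γ         = β≼γ
  ≼-trans (inj₂ α⊏β)  (inj₁ refl) = inj₂ α⊏β
  ≼-trans (inj₂ α⊏β)  (inj₂ β⊏γ)  = inj₂ (⊏-trans α⊏β β⊏γ)

  ≼-total : (α β : Exp m) → α ≼ β ⊎ β ≼ α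
  ≼-total α β with ⊏-trichotomy α β
  ... | inj₁ α⊏β        = inj₁ (inj₂ α⊏β)
  ... | inj₂ (inj₁ α≡β) = inj₁ (inj₁ α≡β)
  ... | inj₂ (inj₂ β⊏α) = inj₂ (inj₂ β⊏α)

  ⊏⇒⋡ : {α β : Exp m} → α ⊏ β → ¬ β ≼ α
  ⊏⇒⋡ {α = α} α⊏β (inj₁ refl) = ⊏-irrefl α α⊏β
  ⊏⇒⋡ {α = α} α⊏β (inj₂ β⊏α)  = ⊏-irrefl α (⊏-trans α⊏β β⊏α)

  ⊹-mono-⊏-≼ : {α α′ β β′ : Exp m} → α ⊏ α′ → β ≼ β′ → α ⊹ β ⊏ α′ ⊹ β′
  ⊹-mono-⊏-≼ {β = β} α⊏α′ (inj₁ refl) = ⊹-monoˡ-⊏ β α⊏α′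
  ⊹-mono-⊏-≼ {α′ = α′} {β} α⊏α′ (inj₂ β⊏β′) = ⊏-trans (⊹-monoˡ-⊏ β α⊏α′) (⊹-monoʳ-⊏ α′ β⊏β′)

  ⊹-mono-≼ : {α α′ β β′ : Exp m} → α ≼ α′ → β ≼ β′ → α ⊹ β ≼ α′ ⊹ β′
  ⊹-mono-≼ (inj₂ α⊏α′) β≼β′         = inj₂ (⊹-mono-⊏-≼ α⊏α′ β≼β′)
  ⊹-mono-≼ (inj₁ refl) (inj₁ refl)  = inj₁ refl
  ⊹-mono-≼ {α = α} (inj₁ refl) (inj₂ β⊏β′) = inj₂ (⊹-monoʳ-⊏ α β⊏β′)

  ≼-totalPreorder : ℕ → TotalPreorder _ _ _
  ≼-totalPreorder m = record
    { Carrier = Exp m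
    ; _≈_ = _≡_
    ; _≲_ = _≼_
    ; isTotalPreorder = record
      { isPreorder = record
        { isEquivalence = ≡.isEquivalence
        ; reflexive = inj₁
        ; trans = ≼-trans }
      ; total = ≼-total } }

  -- Polynomials as formal sums

  -- The linear functional p ↦ Σ c ⋅ h α over the terms (c , α); coefficients, products
  -- and substitutions are all computed through it.
  termSum : (Exp m → ℝ) → Poly m → ℝ
  termSum h []            = 0r
  termSum h ((c , α) ∷ p) = c * h α + termSum h p

  termSum-++ : ∀ h (p q : Poly m) → termSum h (p ++ q) ≡ termSum h p + termSum h q
  termSum-++ h []            q = sym (+-identityˡ _)
  termSum-++ h ((c , α) ∷ p) q = trans (cong (c * h α +_) (termSum-++ h p q)) (sym (+-assoc _ _ _))

  termSum-cong : ∀ {h h′} (p : Poly m) → h ≗ h′ → termSum h p ≡ termSum h′ p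
  termSum-cong []            h≗h′ = refl
  termSum-cong ((c , α) ∷ p) h≗h′ = cong₂ _+_ (cong (c *_) (h≗h′ α)) (termSum-cong p h≗h′)

  termSum-+ : ∀ h h′ (p : Poly m) → termSum (λ α → h α + h′ α) p ≡ termSum h p + termSum h′ p
  termSum-+ h h′ []            = sym (+-identityʳ 0r)
  termSum-+ h h′ ((c , α) ∷ p) =
    trans (cong₂ _+_ (distribˡ c (h α) (h′ α)) (termSum-+ h h′ p)) (+-interchange _ _ _ _)

  termSum-* : ∀ a h (p : Poly m) → termSum (λ α → a * h α) p ≡ a * termSum h p
  termSum-* a h []            = sym (zeroʳ a)
  termSum-* a h ((c , α) ∷ p) =
    trans (cong₂ _+_ (x*[y*z]≡y*[x*z] c a (h α)) (termSum-* a h p)) (sym (distribˡ a _ _))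

  δ : Exp m → Exp m → ℝ
  δ α β with ≡-dec ℕ._≟_ α β
  ... | yes _ = 1r
  ... | no  _ = 0r

  δ-refl : (α : Exp m) → δ α α ≡ 1r
  δ-refl α with ≡-dec ℕ._≟_ α α
  ... | yes _   = refl
  ... | no  α≢α = contradiction refl α≢α

  δ-≢ : {α β : Exp m} → α ≢ β → δ α β ≡ 0r
  δ-≢ {α = α} {β} α≢β with ≡-dec ℕ._≟_ α β
  ... | yes α≡β = contradiction α≡β α≢β
  ... | no  _   = refl

  coeff-termSum : (p : Poly m) (γ : Exp m) → coeff p γ ≡ termSum (λ α → δ α γ) p
  coeff-termSum []            γ = refl
  coeff-termSum ((c , α) ∷ p) γ with ≡-dec ℕ._≟_ α γ
  ... | yes _ = cong₂ _+_ (sym (*-identityʳ c)) (coeff-termSum p γ)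
  ... | no  _ = trans (sym (+-identityˡ _)) (cong₂ _+_ (sym (zeroʳ c)) (coeff-termSum p γ))

  removeTerms : Exp m → Poly m → Poly m
  removeTerms α [] = []
  removeTerms α ((c , β) ∷ p) with ≡-dec ℕ._≟_ β α
  ... | yes _ = removeTerms α p
  ... | no  _ = (c , β) ∷ removeTerms α p

  length-removeTerms : ∀ α (p : Poly m) → length (removeTerms α p) ℕ.≤ length p
  length-removeTerms α [] = ℕ.z≤n
  length-removeTerms α ((c , β) ∷ p) with ≡-dec ℕ._≟_ β α
  ... | yes _ = ℕₚ.m≤n⇒m≤1+n (length-removeTerms α p)
  ... | no  _ = ℕ.s≤s (length-removeTerms α p)

  removeTerms-head : ∀ α c (p : Poly m) → removeTerms α ((c , α) ∷ p) ≡ removeTerms α p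
  removeTerms-head α c p with ≡-dec ℕ._≟_ α α
  ... | yes _   = refl
  ... | no  α≢α = contradiction refl α≢α

  coeff-removeTerms-≡ : ∀ α (p : Poly m) → coeff (removeTerms α p) α ≡ 0r
  coeff-removeTerms-≡ α [] = refl
  coeff-removeTerms-≡ α ((c , β) ∷ p) with ≡-dec ℕ._≟_ β α
  ... | yes _   = coeff-removeTerms-≡ α p
  ... | no  β≢α with ≡-dec ℕ._≟_ β α
  ...   | yes β≡α = contradiction β≡α β≢α
  ...   | no  _   = coeff-removeTerms-≡ α p

  coeff-removeTerms-≢ : ∀ α β (p : Poly m) → β ≢ α → coeff (removeTerms α p) β ≡ coeff p β
  coeff-removeTerms-≢ α β [] _ = refl
  coeff-removeTerms-≢ α β ((c , γ) ∷ p) β≢α with ≡-dec ℕ._≟_ γ α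
  ... | yes refl with ≡-dec ℕ._≟_ γ β
  ...   | yes refl = contradiction refl β≢α
  ...   | no  _    = coeff-removeTerms-≢ α β p β≢α
  coeff-removeTerms-≢ α β ((c , γ) ∷ p) β≢α | no _ with ≡-dec ℕ._≟_ γ β
  ...   | yes _ = cong (c +_) (coeff-removeTerms-≢ α β p β≢α)
  ...   | no  _ = coeff-removeTerms-≢ α β p β≢α

  support-removeTerms : ∀ α β (p : Poly m) → coeff (removeTerms α p) β ≢ 0r → coeff p β ≢ 0r
  support-removeTerms α β p β∈rem with ≡-dec ℕ._≟_ β α
  ... | yes refl = contradiction (coeff-removeTerms-≡ β p) β∈rem
  ... | no  β≢α  = β∈rem ∘ trans (coeff-removeTerms-≢ α β p β≢α)

  termSum-removeTerms : ∀ h α (p : Poly m) → termSum h p ≡ coeff p α * h α + termSum h (removeTerms α p)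
  termSum-removeTerms h α [] = sym (trans (cong (_+ 0r) (zeroˡ (h α))) (+-identityʳ 0r))
  termSum-removeTerms h α ((c , β) ∷ p) with ≡-dec ℕ._≟_ β α
  ... | yes refl = begin
    c * h β + termSum h p                                   ≡⟨ cong (c * h β +_) (termSum-removeTerms h β p) ⟩
    c * h β + (coeff p β * h β + termSum h (removeTerms β p)) ≡⟨ +-assoc _ _ _ ⟨
    c * h β + coeff p β * h β + termSum h (removeTerms β p)
      ≡⟨ cong (_+ termSum h (removeTerms β p)) (distribʳ (h β) c (coeff p β)) ⟨
    (c + coeff p β) * h β + termSum h (removeTerms β p)       ∎
  ... | no _ = begin
    c * h β + termSum h p                                   ≡⟨ cong (c * h β +_) (termSum-removeTerms h α p) ⟩
    c * h β + (coeff p α * h α + termSum h (removeTerms α p)) ≡⟨ x+[y+z]≡y+[x+z] _ _ _ ⟩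
    coeff p α * h α + (c * h β + termSum h (removeTerms α p)) ∎

  termSum-vanishes : ∀ h (p : Poly m) → (∀ α → coeff p α ≢ 0r → h α ≡ 0r) → termSum h p ≡ 0r
  termSum-vanishes h p = go (length p) p ℕₚ.≤-refl
    where
    go : ∀ n (p : Poly _) → length p ℕ.≤ n → (∀ α → coeff p α ≢ 0r → h α ≡ 0r) → termSum h p ≡ 0r
    go _       []              _             _      = refl
    go (suc n) p@((c , α) ∷ q) (ℕ.s≤s |q|≤n) vanish = begin
      termSum h p                                     ≡⟨ termSum-removeTerms h α p ⟩
      coeff p α * h α + termSum h (removeTerms α p)   ≡⟨ cong₂ _+_ (*-vanishes (vanish α)) rest≡0 ⟩
      0r + 0r                                         ≡⟨ +-identityʳ 0r ⟩
      0r                                              ∎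
      where
      shorter : length (removeTerms α p) ℕ.≤ n
      shorter = ℕₚ.≤-trans (ℕₚ.≤-reflexive (cong length (removeTerms-head α c q)))
                           (ℕₚ.≤-trans (length-removeTerms α q) |q|≤n)
      rest≡0 : termSum h (removeTerms α p) ≡ 0r
      rest≡0 = go n (removeTerms α p) shorter λ β → vanish β ∘ support-removeTerms α β p

  termSum-null : ∀ h (p : Poly m) → (∀ α → coeff p α ≡ 0r) → termSum h p ≡ 0r
  termSum-null h p null = termSum-vanishes h p λ α α∈p → contradiction (null α) α∈p

  termSum-concentrated : ∀ h (p : Poly m) α → (∀ β → coeff p β ≢ 0r → β ≢ α → h β ≡ 0r) →
                         termSum h p ≡ coeff p α * h α
  termSum-concentrated h p α vanish = begin
    termSum h p                                    ≡⟨ termSum-removeTerms h α p ⟩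
    coeff p α * h α + termSum h (removeTerms α p)
      ≡⟨ cong (coeff p α * h α +_) (termSum-vanishes h (removeTerms α p) vanish′) ⟩
    coeff p α * h α + 0r                           ≡⟨ +-identityʳ _ ⟩
    coeff p α * h α                                ∎
    where
    vanish′ : ∀ β → coeff (removeTerms α p) β ≢ 0r → h β ≡ 0r
    vanish′ β β∈rem = vanish β (support-removeTerms α β p β∈rem)
      λ { refl → β∈rem (coeff-removeTerms-≡ β p) }

  infix 4 _≈_
  record _≈_ (p q : Poly m) : Set where
    constructor mk≈
    field coeff-≡ : ∀ α → coeff p α ≡ coeff q α
  open _≈_

  ≈-refl : {p : Poly m} → p ≈ p
  ≈-refl = mk≈ λ _ → refl

  ≈-sym : {p q : Poly m} → p ≈ q → q ≈ p
  ≈-sym p≈q = mk≈ λ α → sym (coeff-≡ p≈q α)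

  ≈-trans : {p q r : Poly m} → p ≈ q → q ≈ r → p ≈ r
  ≈-trans p≈q q≈r = mk≈ λ α → trans (coeff-≡ p≈q α) (coeff-≡ q≈r α)

  negate : Poly m → Poly m
  negate []            = []
  negate ((c , α) ∷ p) = (- c , α) ∷ negate p

  termSum-negate : ∀ h (p : Poly m) → termSum h (negate p) ≡ - termSum h p
  termSum-negate h []            = sym -0#≈0#
  termSum-negate h ((c , α) ∷ p) =
    trans (cong₂ _+_ (sym (-‿distribˡ-* c (h α))) (termSum-negate h p)) (-‿+-comm _ _)

  -- termSum only sees the coefficients: the difference p − q has none left.
  termSum-≈ : ∀ h {p q : Poly m} → p ≈ q → termSum h p ≡ termSum h q
  termSum-≈ h {p} {q} p≈q = x∙y⁻¹≈ε⇒x≈y _ _ (begin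
    termSum h p + - termSum h q         ≡⟨ cong (termSum h p +_) (termSum-negate h q) ⟨
    termSum h p + termSum h (negate q)  ≡⟨ termSum-++ h p (negate q) ⟨
    termSum h (p ++ negate q)           ≡⟨ termSum-null h (p ++ negate q) coeff-difference ⟩
    0r                                  ∎)
    where
    coeff-difference : ∀ α → coeff (p ++ negate q) α ≡ 0r
    coeff-difference α = begin
      coeff (p ++ negate q) α                                  ≡⟨ coeff-termSum (p ++ negate q) α ⟩
      termSum (λ β → δ β α) (p ++ negate q)                    ≡⟨ termSum-++ _ p (negate q) ⟩
      termSum (λ β → δ β α) p + termSum (λ β → δ β α) (negate q) ≡⟨ cong (_ +_) (termSum-negate _ q) ⟩
      termSum (λ β → δ β α) p + - termSum (λ β → δ β α) q
        ≡⟨ cong₂ (λ x y → x + - y) (coeff-termSum p α) (coeff-termSum q α) ⟨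
      coeff p α + - coeff q α
        ≡⟨ cong (λ x → x + - coeff q α) (coeff-≡ p≈q α) ⟩
      coeff q α + - coeff q α                                  ≡⟨ -‿inverseʳ (coeff q α) ⟩
      0r                                                       ∎

  termSum-concatMap : ∀ h k (f : ℝ × Exp m → Poly m) (p : Poly m) →
                      (∀ c α → termSum h (f (c , α)) ≡ c * k α) → termSum h (concatMap f p) ≡ termSum k p
  termSum-concatMap h k f []            hf = refl
  termSum-concatMap h k f ((c , α) ∷ p) hf =
    trans (termSum-++ h (f (c , α)) (concatMap f p)) (cong₂ _+_ (hf c α) (termSum-concatMap h k f p hf))

  termSum-map : ∀ h c α (g : ℝ × Exp m → ℝ × Exp m) (q : Poly m) → (∀ d β → g (d , β) ≡ (c * d , α ⊹ β)) →
                termSum h (map g q) ≡ c * termSum (λ β → h (α ⊹ β)) q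
  termSum-map h c α g []            hg = sym (zeroʳ c)
  termSum-map h c α g ((d , β) ∷ q) hg rewrite hg d β =
    trans (cong₂ _+_ (*-assoc c d _) (termSum-map h c α g q hg)) (sym (distribˡ c _ _))

  termSum-⊗ : ∀ h (p q : Poly m) → termSum h (p ⊗ q) ≡ termSum (λ α → termSum (λ β → h (α ⊹ β)) q) p
  termSum-⊗ h p q = termSum-concatMap h _ _ p λ c α → termSum-map h c α _ q λ d β → refl

  coeff-⊗ : (p q : Poly m) (γ : Exp m) → coeff (p ⊗ q) γ ≡ termSum (λ α → termSum (λ β → δ (α ⊹ β) γ) q) p
  coeff-⊗ p q γ = trans (coeff-termSum (p ⊗ q) γ) (termSum-⊗ _ p q)

  termSum-comm : ∀ {m′} (f : Exp m → Exp m′ → ℝ) (p : Poly m) (q : Poly m′) →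
                 termSum (λ α → termSum (f α) q) p ≡ termSum (λ β → termSum (λ α → f α β) p) q
  termSum-comm f []            q = sym (termSum-vanishes _ q λ _ _ → refl)
  termSum-comm f ((c , α) ∷ p) q = begin
    c * termSum (f α) q + termSum (λ α → termSum (f α) q) p
      ≡⟨ cong₂ _+_ (sym (termSum-* c (f α) q)) (termSum-comm f p q) ⟩
    termSum (λ β → c * f α β) q + termSum (λ β → termSum (λ α → f α β) p) q ≡⟨ termSum-+ _ _ q ⟨
    termSum (λ β → c * f α β + termSum (λ α → f α β) p) q          ∎

  ⊗-cong : {p p′ q q′ : Poly m} → p ≈ p′ → q ≈ q′ → p ⊗ q ≈ p′ ⊗ q′
  ⊗-cong {p = p} {p′} {q} {q′} p≈p′ q≈q′ = mk≈ λ γ → begin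
    coeff (p ⊗ q) γ                                     ≡⟨ coeff-⊗ p q γ ⟩
    termSum (λ α → termSum (λ β → δ (α ⊹ β) γ) q) p     ≡⟨ termSum-cong p (λ α → termSum-≈ _ q≈q′) ⟩
    termSum (λ α → termSum (λ β → δ (α ⊹ β) γ) q′) p    ≡⟨ termSum-≈ _ p≈p′ ⟩
    termSum (λ α → termSum (λ β → δ (α ⊹ β) γ) q′) p′   ≡⟨ coeff-⊗ p′ q′ γ ⟨
    coeff (p′ ⊗ q′) γ                                   ∎

  ⊗-comm : (p q : Poly m) → p ⊗ q ≈ q ⊗ p
  ⊗-comm p q = mk≈ λ γ → begin
    coeff (p ⊗ q) γ                                    ≡⟨ coeff-⊗ p q γ ⟩
    termSum (λ α → termSum (λ β → δ (α ⊹ β) γ) q) p    ≡⟨ termSum-comm _ p q ⟩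
    termSum (λ β → termSum (λ α → δ (α ⊹ β) γ) p) q
      ≡⟨ termSum-cong q (λ β → termSum-cong p λ α → cong (λ x → δ x γ) (⊹-comm α β)) ⟩
    termSum (λ β → termSum (λ α → δ (β ⊹ α) γ) p) q    ≡⟨ coeff-⊗ q p γ ⟨
    coeff (q ⊗ p) γ                                    ∎

  ⊗-assoc : (p q r : Poly m) → (p ⊗ q) ⊗ r ≈ p ⊗ (q ⊗ r)
  ⊗-assoc p q r = mk≈ λ ε → begin
    coeff ((p ⊗ q) ⊗ r) ε                                                        ≡⟨ coeff-⊗ (p ⊗ q) r ε ⟩
    termSum (λ x → termSum (λ γ → δ (x ⊹ γ) ε) r) (p ⊗ q)                        ≡⟨ termSum-⊗ _ p q ⟩
    termSum (λ α → termSum (λ β → termSum (λ γ → δ (α ⊹ β ⊹ γ) ε) r) q) p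
      ≡⟨ termSum-cong p (λ α → termSum-cong q λ β → termSum-cong r λ γ → cong (λ x → δ x ε) (⊹-assoc α β γ)) ⟩
    termSum (λ α → termSum (λ β → termSum (λ γ → δ (α ⊹ (β ⊹ γ)) ε) r) q) p
      ≡⟨ termSum-cong p (λ α → termSum-⊗ _ q r) ⟨
    termSum (λ α → termSum (λ y → δ (α ⊹ y) ε) (q ⊗ r)) p                        ≡⟨ coeff-⊗ p (q ⊗ r) ε ⟨
    coeff (p ⊗ (q ⊗ r)) ε                                                        ∎

  termSum-const⊗ : ∀ h c (p : Poly m) → termSum h (const c ⊗ p) ≡ c * termSum h p
  termSum-const⊗ h c p =
    trans (termSum-⊗ h (const c) p) (trans (+-identityʳ _) (cong (c *_) (termSum-cong p λ β → cong h (⊹-identityˡ β))))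

  ⊗-identityˡ : (p : Poly m) → const 1r ⊗ p ≈ p
  ⊗-identityˡ p = mk≈ λ β → begin
    coeff (const 1r ⊗ p) β                       ≡⟨ coeff-termSum (const 1r ⊗ p) β ⟩
    termSum (λ α → δ α β) (const 1r ⊗ p)         ≡⟨ termSum-const⊗ _ 1r p ⟩
    1r * termSum (λ α → δ α β) p                 ≡⟨ *-identityˡ _ ⟩
    termSum (λ α → δ α β) p                      ≡⟨ coeff-termSum p β ⟨
    coeff p β                                    ∎

  ⊗-interchange : (p q r s : Poly m) → (p ⊗ q) ⊗ (r ⊗ s) ≈ (p ⊗ r) ⊗ (q ⊗ s)
  ⊗-interchange p q r s =
    ≈-trans (⊗-assoc p q (r ⊗ s)) (≈-trans (⊗-cong (≈-refl {p = p}) middle) (≈-sym (⊗-assoc p r (q ⊗ s))))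
    where
    middle : q ⊗ (r ⊗ s) ≈ r ⊗ (q ⊗ s)
    middle = ≈-trans (≈-sym (⊗-assoc q r s)) (≈-trans (⊗-cong (⊗-comm q r) (≈-refl {p = s})) (⊗-assoc r q s))

  ^-+ : (p : Poly m) (a b : ℕ) → p ^ᵖ (a ℕ.+ b) ≈ (p ^ᵖ a) ⊗ (p ^ᵖ b)
  ^-+ p zero    b = ≈-sym (⊗-identityˡ (p ^ᵖ b))
  ^-+ p (suc a) b = ≈-trans (⊗-cong (≈-refl {p = p}) (^-+ p a b)) (≈-sym (⊗-assoc p (p ^ᵖ a) (p ^ᵖ b)))

  monoEval-⊹ : ∀ {s} (g : Vec (Poly m) s) (e f : Exp s) → monoEval g (e ⊹ f) ≈ monoEval g e ⊗ monoEval g f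
  monoEval-⊹ []       []      []      = ≈-sym (⊗-identityˡ (const 1r))
  monoEval-⊹ (g ∷ gs) (a ∷ e) (b ∷ f) =
    ≈-trans (⊗-cong (^-+ g a b) (monoEval-⊹ gs e f)) (⊗-interchange (g ^ᵖ a) (g ^ᵖ b) _ _)

  monoEval-𝟘 : ∀ {s} (g : Vec (Poly m) s) → monoEval g 𝟘 ≈ const 1r
  monoEval-𝟘 []       = ≈-refl
  monoEval-𝟘 (g ∷ gs) = ≈-trans (⊗-identityˡ _) (monoEval-𝟘 gs)

  termSum-subst : ∀ {s} h (Q : Poly s) (g : Vec (Poly m) s) →
                  termSum h (subst Q g) ≡ termSum (λ e → termSum h (monoEval g e)) Q
  termSum-subst h []            g = refl
  termSum-subst h ((c , e) ∷ Q) g =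
    trans (termSum-++ h (const c ⊗ monoEval g e) (subst Q g))
          (cong₂ _+_ (termSum-const⊗ h c (monoEval g e)) (termSum-subst h Q g))

  coeff-subst : ∀ {s} (Q : Poly s) (g : Vec (Poly m) s) β →
                coeff (subst Q g) β ≡ termSum (λ e → coeff (monoEval g e) β) Q
  coeff-subst Q g β = trans (coeff-termSum (subst Q g) β)
    (trans (termSum-subst _ Q g) (termSum-cong Q λ e → sym (coeff-termSum (monoEval g e) β)))

  subst-⊗ : ∀ {s} (Q Q′ : Poly s) (g : Vec (Poly m) s) → subst (Q ⊗ Q′) g ≈ subst Q g ⊗ subst Q′ g
  subst-⊗ Q Q′ g = mk≈ λ β → begin
    coeff (subst (Q ⊗ Q′) g) β                                      ≡⟨ coeff-subst (Q ⊗ Q′) g β ⟩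
    termSum (λ e → coeff (monoEval g e) β) (Q ⊗ Q′)                 ≡⟨ termSum-⊗ _ Q Q′ ⟩
    termSum (λ e → termSum (λ e′ → coeff (monoEval g (e ⊹ e′)) β) Q′) Q
      ≡⟨ termSum-cong Q (λ e → termSum-cong Q′ λ e′ →
           trans (coeff-≡ (monoEval-⊹ g e e′) β) (coeff-⊗ (monoEval g e) (monoEval g e′) β)) ⟩
    termSum (λ e → termSum (λ e′ → termSum (λ α → termSum (λ α′ → δ (α ⊹ α′) β) (monoEval g e′)) (monoEval g e)) Q′) Q
      ≡⟨ termSum-cong Q (λ e → sym (termSum-comm _ (monoEval g e) Q′)) ⟩
    termSum (λ e → termSum (λ α → termSum (λ e′ → termSum (λ α′ → δ (α ⊹ α′) β) (monoEval g e′)) Q′) (monoEval g e)) Q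
      ≡⟨ termSum-cong Q (λ e → termSum-cong (monoEval g e) λ α → sym (termSum-subst _ Q′ g)) ⟩
    termSum (λ e → termSum (λ α → termSum (λ α′ → δ (α ⊹ α′) β) (subst Q′ g)) (monoEval g e)) Q
      ≡⟨ termSum-subst _ Q g ⟨
    termSum (λ α → termSum (λ α′ → δ (α ⊹ α′) β) (subst Q′ g)) (subst Q g)
      ≡⟨ coeff-⊗ (subst Q g) (subst Q′ g) β ⟨
    coeff (subst Q g ⊗ subst Q′ g) β                                       ∎

  subst-1 : ∀ {s} (g : Vec (Poly m) s) → subst (const 1r) g ≈ const 1r
  subst-1 g = mk≈ λ β →
    trans (coeff-subst (const 1r) g β) (trans (+-identityʳ _) (trans (*-identityˡ _) (coeff-≡ (monoEval-𝟘 g) β)))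

  subst-^ : ∀ {s} (Q : Poly s) n (g : Vec (Poly m) s) → subst (Q ^ᵖ n) g ≈ subst Q g ^ᵖ n
  subst-^ Q zero    g = subst-1 g
  subst-^ Q (suc n) g = ≈-trans (subst-⊗ Q (Q ^ᵖ n) g) (⊗-cong (≈-refl {p = subst Q g}) (subst-^ Q n g))

  powProduct : ∀ {k} → (Fin k → Poly m) → (Fin k → ℕ) → Poly m
  powProduct {k = zero}  b e = const 1r
  powProduct {k = suc k} b e = (b zero ^ᵖ e zero) ⊗ powProduct (b ∘ suc) (e ∘ suc)

  subst-powProduct : ∀ {s k} (b : Fin k → Poly s) e (g : Vec (Poly m) s) →
                     subst (powProduct b e) g ≈ powProduct (λ i → subst (b i) g) e
  subst-powProduct {k = zero}  b e g = subst-1 g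
  subst-powProduct {k = suc k} b e g = ≈-trans (subst-⊗ (b zero ^ᵖ e zero) _ g)
    (⊗-cong (subst-^ (b zero) (e zero) g) (subst-powProduct (b ∘ suc) (e ∘ suc) g))

  linearCombination : ∀ {M} → (Fin M → ℝ) → (Fin M → Poly m) → Poly m
  linearCombination {M = zero}  c Q = []
  linearCombination {M = suc M} c Q = (const (c zero) ⊗ Q zero) ++ linearCombination (c ∘ suc) (Q ∘ suc)

  termSum-linearCombination : ∀ {M} h (c : Fin M → ℝ) (Q : Fin M → Poly m) →
                              termSum h (linearCombination c Q) ≡ sum (λ i → c i * termSum h (Q i))
  termSum-linearCombination {M = zero}  h c Q = refl
  termSum-linearCombination {M = suc M} h c Q =
    trans (termSum-++ h (const (c zero) ⊗ Q zero) _)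
          (cong₂ _+_ (termSum-const⊗ h (c zero) (Q zero)) (termSum-linearCombination h (c ∘ suc) (Q ∘ suc)))

  LinearRelation-termSum : ∀ {M} {c : Fin M → ℝ} {Q : Fin M → Poly m} →
    LinearRelation (λ i → coeff (Q i)) c → ∀ h → sum (λ i → c i * termSum h (Q i)) ≡ 0r
  LinearRelation-termSum {c = c} {Q} relation h =
    trans (sym (termSum-linearCombination h c Q)) (termSum-null h (linearCombination c Q) coeff≡0)
    where
    coeff≡0 : ∀ α → coeff (linearCombination c Q) α ≡ 0r
    coeff≡0 α = begin
      coeff (linearCombination c Q) α                          ≡⟨ coeff-termSum (linearCombination c Q) α ⟩
      termSum (λ β → δ β α) (linearCombination c Q)            ≡⟨ termSum-linearCombination _ c Q ⟩
      sum (λ i → c i * termSum (λ β → δ β α) (Q i))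
        ≡⟨ sum-cong-≗ (λ i → cong (c i *_) (coeff-termSum (Q i) α)) ⟨
      sum (λ i → c i * coeff (Q i) α)                          ≡⟨ relation α ⟩
      0r                                                       ∎

  -- Least exponents

  record IsLeast (p : Poly m) (α : Exp m) : Set where
    field
      nonzero : coeff p α ≢ 0r
      minimal : ∀ {β} → coeff p β ≢ 0r → α ≼ β

    vanishes-below : ∀ {β} → β ⊏ α → coeff p β ≡ 0r
    vanishes-below β⊏α = ≢0-stable λ β∈p → ⊏⇒⋡ β⊏α (minimal β∈p)
  open IsLeast

  LeastExponent⇒IsLeast : {p : Poly m} {α : Exp m} → LeastExponent p α → IsLeast p α
  LeastExponent⇒IsLeast (α∈p , least) = record
    { nonzero = α∈p
    ; minimal = λ β∈p → case least _ β∈p of λ { (inj₁ refl) → inj₁ refl ; (inj₂ α≺β) → inj₂ (mk⊏ α≺β) } }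

  IsLeast-1 : IsLeast (const {m} 1r) 𝟘
  IsLeast-1 {m} = record { nonzero = nonzero′ ; minimal = minimal′ }
    where
    nonzero′ : coeff (const {m} 1r) 𝟘 ≢ 0r
    nonzero′ with ≡-dec ℕ._≟_ (replicate m 0) (replicate m 0)
    ... | yes _   = 1≢0 ∘ trans (sym (+-identityʳ 1r))
    ... | no  𝟘≢𝟘 = contradiction refl 𝟘≢𝟘
    minimal′ : ∀ {β} → coeff (const {m} 1r) β ≢ 0r → 𝟘 ≼ β
    minimal′ {β} β∈1 with ≡-dec ℕ._≟_ (replicate m 0) β
    ... | yes 𝟘≡β = inj₁ 𝟘≡β
    ... | no  _   = contradiction refl β∈1

  IsLeast-⊗ : {p q : Poly m} {α β : Exp m} → IsLeast p α → IsLeast q β → IsLeast (p ⊗ q) (α ⊹ β)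
  IsLeast-⊗ {p = p} {q} {α} {β} least-p least-q = record { nonzero = nonzero′ ; minimal = minimal′ }
    where
    -- T α′ γ is the coefficient of γ in X^α′ ⋅ q.
    T : Exp _ → Exp _ → ℝ
    T α′ γ = termSum (λ β′ → δ (α′ ⊹ β′) γ) q

    T-α : T α (α ⊹ β) ≡ coeff q β
    T-α = begin
      T α (α ⊹ β)
        ≡⟨ termSum-concentrated _ q β (λ β′ _ β′≢β → δ-≢ (β′≢β ∘ ⊹-cancelˡ α β′ β)) ⟩
      coeff q β * δ (α ⊹ β) (α ⊹ β)  ≡⟨ cong (coeff q β *_) (δ-refl (α ⊹ β)) ⟩
      coeff q β * 1r                 ≡⟨ *-identityʳ _ ⟩
      coeff q β                      ∎

    T-other : ∀ α′ → coeff p α′ ≢ 0r → α′ ≢ α → T α′ (α ⊹ β) ≡ 0r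
    T-other α′ α′∈p α′≢α = termSum-vanishes _ q λ β′ β′∈q → δ-≢ λ eq →
      ⊏-irrefl _ (≡.subst (α ⊹ β ⊏_) eq (⊹-mono-⊏-≼ α⊏α′ (minimal least-q β′∈q)))
      where
      α⊏α′ : α ⊏ α′
      α⊏α′ = case minimal least-p α′∈p of λ { (inj₁ α≡α′) → contradiction (sym α≡α′) α′≢α ; (inj₂ α⊏α′) → α⊏α′ }

    nonzero′ : coeff (p ⊗ q) (α ⊹ β) ≢ 0r
    nonzero′ = *-≢0 (nonzero least-p) (nonzero least-q) ∘ trans (sym (begin
      coeff (p ⊗ q) (α ⊹ β)                ≡⟨ coeff-⊗ p q (α ⊹ β) ⟩
      termSum (λ α′ → T α′ (α ⊹ β)) p      ≡⟨ termSum-concentrated _ p α T-other ⟩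
      coeff p α * T α (α ⊹ β)              ≡⟨ cong (coeff p α *_) T-α ⟩
      coeff p α * coeff q β                ∎))

    vanishes-below′ : ∀ {γ} → γ ⊏ α ⊹ β → coeff (p ⊗ q) γ ≡ 0r
    vanishes-below′ {γ} γ⊏αβ = trans (coeff-⊗ p q γ) (termSum-vanishes _ p λ α′ α′∈p →
      termSum-vanishes _ q λ β′ β′∈q → δ-≢ {α = α′ ⊹ β′} {γ} λ { refl →
        ⊏⇒⋡ γ⊏αβ (⊹-mono-≼ (minimal least-p α′∈p) (minimal least-q β′∈q)) })

    minimal′ : ∀ {γ} → coeff (p ⊗ q) γ ≢ 0r → α ⊹ β ≼ γ
    minimal′ {γ} γ∈pq with ≼-total (α ⊹ β) γ
    ... | inj₁ αβ≼γ        = αβ≼γ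
    ... | inj₂ (inj₁ refl) = inj₁ refl
    ... | inj₂ (inj₂ γ⊏αβ) = contradiction (vanishes-below′ γ⊏αβ) γ∈pq

  IsLeast-^ : {p : Poly m} {α : Exp m} (n : ℕ) → IsLeast p α → IsLeast (p ^ᵖ n) (n ·ᵉ α)
  IsLeast-^ zero    _     = IsLeast-1
  IsLeast-^ (suc n) least = IsLeast-⊗ least (IsLeast-^ n least)

  IsLeast-powProduct : ∀ {k} {b : Fin k → Poly m} {α : Fin k → Exp m} (e : Fin k → ℕ) →
                       (∀ i → IsLeast (b i) (α i)) → IsLeast (powProduct b e) (weightedSum e α)
  IsLeast-powProduct {k = zero}  e _     = IsLeast-1
  IsLeast-powProduct {k = suc k} e least =
    IsLeast-⊗ (IsLeast-^ (e zero) (least zero)) (IsLeast-powProduct (e ∘ suc) (least ∘ suc))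

  distinctLeast⇒trivial : ∀ {M} (p : Fin M → Poly m) (α : Fin M → Exp m) → (∀ i → IsLeast (p i) (α i)) →
                          (∀ {i i′} → α i ≡ α i′ → i ≡ i′) →
                          ∀ {c} → LinearRelation (λ i → coeff (p i)) c → ¬ Nontrivial c
  distinctLeast⇒trivial p α least distinct {c} relation nontrivial
    with minimiser (≼-totalPreorder _) (λ i → c i ≢ 0r) (λ i → ¬? (c i ≟ 0r)) α nontrivial
  ... | i* , cᵢ*≢0 , lowest = *-≢0 cᵢ*≢0 (nonzero (least i*)) (begin
    c i* * coeff (p i*) (α i*)               ≡⟨ sum-concentrated _ i* others ⟨
    sum (λ i → c i * coeff (p i) (α i*))     ≡⟨ relation (α i*) ⟩
    0r                                       ∎)
    where
    others : ∀ i → i ≢ i* → c i * coeff (p i) (α i*) ≡ 0r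
    others i i≢i* = *-vanishes λ cᵢ≢0 → case lowest i cᵢ≢0 of λ
      { (inj₁ αᵢ*≡αᵢ) → contradiction (sym (distinct αᵢ*≡αᵢ)) i≢i*
      ; (inj₂ αᵢ*⊏αᵢ) → vanishes-below (least i) αᵢ*⊏αᵢ }

  ExponentBound : ℕ → Exp m → Set
  ExponentBound B = VecAll.All (ℕ._≤ B)

  DegreeBound : ℕ → Poly m → Set
  DegreeBound B = All (λ t → ExponentBound B (proj₂ t))

  ExponentBound-weaken : ∀ {B C} {α : Exp m} → B ℕ.≤ C → ExponentBound B α → ExponentBound C α
  ExponentBound-weaken B≤C = VecAll.map (λ a≤B → ℕₚ.≤-trans a≤B B≤C)

  ExponentBound-𝟘 : ExponentBound 0 (𝟘 {m})
  ExponentBound-𝟘 {zero}  = []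
  ExponentBound-𝟘 {suc m} = ℕ.z≤n ∷ ExponentBound-𝟘

  ExponentBound-⊹ : ∀ {B C} {α β : Exp m} → ExponentBound B α → ExponentBound C β → ExponentBound (B ℕ.+ C) (α ⊹ β)
  ExponentBound-⊹ []          []          = []
  ExponentBound-⊹ (a≤B ∷ α≤B) (b≤C ∷ β≤C) = ℕₚ.+-mono-≤ a≤B b≤C ∷ ExponentBound-⊹ α≤B β≤C

  exponentBound : (α : Exp m) → ∃[ B ] ExponentBound B α
  exponentBound []      = 0 , []
  exponentBound (a ∷ α) with exponentBound α
  ... | B , α≤B = a ℕ.⊔ B , ℕₚ.m≤m⊔n a B ∷ ExponentBound-weaken (ℕₚ.m≤n⊔m a B) α≤B

  DegreeBound-weaken : ∀ {B C} {p : Poly m} → B ℕ.≤ C → DegreeBound B p → DegreeBound C p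
  DegreeBound-weaken B≤C = All.map (ExponentBound-weaken B≤C)

  DegreeBound-1 : DegreeBound 0 (const {m} 1r)
  DegreeBound-1 = ExponentBound-𝟘 ∷ []

  DegreeBound-⊗ : ∀ {B C} {p q : Poly m} → DegreeBound B p → DegreeBound C q → DegreeBound (B ℕ.+ C) (p ⊗ q)
  DegreeBound-⊗ p≤B q≤C = concat⁺ (map⁺ (All.map (λ α≤B → map⁺ (All.map (ExponentBound-⊹ α≤B) q≤C)) p≤B))

  DegreeBound-^ : ∀ {B} {p : Poly m} n → DegreeBound B p → DegreeBound (n ℕ.* B) (p ^ᵖ n)
  DegreeBound-^ zero    _   = DegreeBound-1
  DegreeBound-^ (suc n) p≤B = DegreeBound-⊗ p≤B (DegreeBound-^ n p≤B)

  DegreeBound-powProduct : ∀ {k d D} {b : Fin k → Poly m} {e : Fin k → ℕ} →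
    (∀ i → e i ℕ.≤ D) → (∀ i → DegreeBound d (b i)) → DegreeBound (k ℕ.* (D ℕ.* d)) (powProduct b e)
  DegreeBound-powProduct {k = zero}  _   _   = DegreeBound-1
  DegreeBound-powProduct {k = suc k} {d} {e = e} e≤D b≤d = DegreeBound-⊗
    (DegreeBound-weaken (ℕₚ.*-monoˡ-≤ d (e≤D zero)) (DegreeBound-^ (e zero) (b≤d zero)))
    (DegreeBound-powProduct (e≤D ∘ suc) (b≤d ∘ suc))

  degreeBound : (p : Poly m) → ∃[ B ] DegreeBound B p
  degreeBound []            = 0 , []
  degreeBound ((c , α) ∷ p) with exponentBound α | degreeBound p
  ... | B , α≤B | C , p≤C = B ℕ.⊔ C ,
    ExponentBound-weaken (ℕₚ.m≤m⊔n B C) α≤B ∷ DegreeBound-weaken (ℕₚ.m≤n⊔m B C) p≤C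

  degreeBound-family : ∀ {k} (b : Fin k → Poly m) → ∃[ d ] (∀ i → DegreeBound d (b i))
  degreeBound-family {k = zero}  b = 0 , λ ()
  degreeBound-family {k = suc k} b with degreeBound (b zero) | degreeBound-family (b ∘ suc)
  ... | B , b₀≤B | C , b≤C = B ℕ.⊔ C , λ
    { zero    → DegreeBound-weaken (ℕₚ.m≤m⊔n B C) b₀≤B
    ; (suc i) → DegreeBound-weaken (ℕₚ.m≤n⊔m B C) (b≤C i) }

  coeff-unbounded : ∀ {B} {p : Poly m} {β} → DegreeBound B p → ¬ ExponentBound B β → coeff p β ≡ 0r
  coeff-unbounded {p = []}            []          _    = refl
  coeff-unbounded {p = (c , α) ∷ p} {β} (α≤B ∷ p≤B) β≰B with ≡-dec ℕ._≟_ α β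
  ... | yes refl = contradiction α≤B β≰B
  ... | no  _    = coeff-unbounded p≤B β≰B

  digitVector : ∀ {B s} → Fin (B ℕ.^ s) → Exp s
  digitVector j = Vec.tabulate (toℕ ∘ finToFun j)

  digitVector-surjective : ∀ {B s} (β : Exp s) → (∀ i → lookup β i ℕ.< B) → ∃[ j ] digitVector {B} j ≡ β
  digitVector-surjective β β<B = funToFin digits , (begin
    Vec.tabulate (toℕ ∘ finToFun (funToFin digits))  ≡⟨ tabulate-cong (cong toℕ ∘ finToFun-funToFin digits) ⟩
    Vec.tabulate (toℕ ∘ digits)                      ≡⟨ tabulate-cong (λ i → toℕ-fromℕ< (β<B i)) ⟩
    Vec.tabulate (lookup β)                          ≡⟨ tabulate∘lookup β ⟩
    β                                                ∎)
    where
    digits = λ i → fromℕ< (β<B i)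

  -- The coordinates are the coefficients at the (B+1)^s vectors with entries ≤ B.
  boundedDependence : ∀ {s M B} → suc B ℕ.^ s ℕ.< M → (Q : Fin M → Poly s) → (∀ i → DegreeBound B (Q i)) →
                      ∃[ c ] Nontrivial c × LinearRelation (λ i → coeff (Q i)) c
  boundedDependence {B = B} small Q Q≤B with linearDependence small (λ i j → coeff (Q i) (digitVector j))
  ... | c , nontrivial , relation = c , nontrivial , relation′
    where
    relation′ : ∀ β → sum (λ i → c i * coeff (Q i) β) ≡ 0r
    relation′ β with VecAll.all? (ℕ._≤? B) β
    ... | yes β≤B = case digitVector-surjective {suc B} β (ℕ.s≤s ∘ lookup⁺ β≤B) of λ { (j , refl) → relation j }
    ... | no  β≰B = sum-zero _ λ i → trans (cong (c i *_) (coeff-unbounded (Q≤B i) β≰B)) (zeroʳ (c i))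

  -- Algebraic relations

  record AlgebraicRelation {k} (b : Fin k → Poly m) : Set where
    field
      size               : ℕ
      exponent           : Fin size → Fin k → ℕ
      exponent-injective : ∀ {i i′} → exponent i ≗ exponent i′ → i ≡ i′
      coefficient        : Fin size → ℝ
      nontrivial         : Nontrivial coefficient
      relation           : LinearRelation (λ i → coeff (powProduct b (exponent i))) coefficient

  algebraicRelation : ∀ {s k} → s ℕ.< k → (b : Fin k → Poly s) → AlgebraicRelation b
  algebraicRelation {s} {k} s<k b = record
    { size               = D ℕ.^ k
    ; exponent           = E
    ; exponent-injective = λ E≗E′ → finToFun-injective (toℕ-injective ∘ E≗E′)
    ; coefficient        = proj₁ dependence
    ; nontrivial         = proj₁ (proj₂ dependence)
    ; relation           = proj₂ (proj₂ dependence) }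
    where
    d = proj₁ (degreeBound-family b)
    D = proj₁ (power-outgrows s<k d)
    E : Fin (D ℕ.^ k) → Fin k → ℕ
    E i j = toℕ (finToFun i j)
    dependence = boundedDependence (proj₂ (power-outgrows s<k d)) (λ i → powProduct b (E i))
      λ i → DegreeBound-powProduct (λ j → ℕₚ.<⇒≤ (toℕ<n (finToFun i j))) (proj₂ (degreeBound-family b))

  AlgebraicRelation-subst : ∀ {s k} {b : Fin k → Poly s} (g : Vec (Poly m) s) →
                            AlgebraicRelation b → AlgebraicRelation (λ i → subst (b i) g)
  AlgebraicRelation-subst {b = b} g rel = record
    { size = size ; exponent = exponent ; exponent-injective = exponent-injective
    ; coefficient = coefficient ; nontrivial = nontrivial
    ; relation = λ β → begin
        sum (λ i → coefficient i * coeff (powProduct (λ j → subst (b j) g) (exponent i)) β)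
          ≡⟨ sum-cong-≗ (λ i → cong (coefficient i *_)
               (trans (sym (coeff-≡ (subst-powProduct b (exponent i) g) β)) (coeff-subst (powProduct b (exponent i)) g β))) ⟩
        sum (λ i → coefficient i * termSum (λ e → coeff (monoEval g e) β) (powProduct b (exponent i)))
          ≡⟨ LinearRelation-termSum {Q = λ i → powProduct b (exponent i)} relation (λ e → coeff (monoEval g e) β) ⟩
        0r ∎ }
    where open AlgebraicRelation rel

  noAlgebraicRelation : ∀ {k} {a : Fin k → Poly m} {α : Fin k → Exp m} →
                        (∀ i → IsLeast (a i) (α i)) → LinearlyIndependent α → ¬ AlgebraicRelation a
  noAlgebraicRelation {a = a} {α} least independent rel =
    distinctLeast⇒trivial (λ i → powProduct a (exponent i)) (λ i → weightedSum (exponent i) α)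
      (λ i → IsLeast-powProduct (exponent i) least)
      (λ eq → exponent-injective (weightedSum-injective independent eq)) relation nontrivial
    where open AlgebraicRelation rel

lemma3 : (R : RealField) → let open Poly R in
    (n₁ n₂ s N : ℕ) →
    (g : Vec (Poly (n₁ ℕ.+ n₂)) s) →
    (P : Fin N → Poly s) →
    (k : ℕ) → (σ : Fin k → Fin N) → (α : Fin k → Vec ℕ (n₁ ℕ.+ n₂)) →
    (∀ i → LeastExponent (subst (P (σ i)) g) (α i)) →
    LinearlyIndependent α →
    k ℕ.≤ s
lemma3 R n₁ n₂ s N g P k σ α least independent = ℕₚ.≮⇒≥ λ s<k →
  noAlgebraicRelation R (λ i → LeastExponent⇒IsLeast R (least i)) independent
    (AlgebraicRelation-subst R g (algebraicRelation R s<k (P ∘ σ)))
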